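{- For any integer $t\geq 3$, there exists a connected graph $G$ such that $fix(G)+F_{xt}(G)=t$.
   Context: All graphs are finite and simple. A fixing set of $G$ is a set $F\subseteq V(G)$ such that the only automorphism fixing every vertex of $F$ is the identity; $fix(G)$ is the minimum size of a fixing set. A fixatic partition is a partition of $V(G)$ into classes each of which is a fixing set; $F_{xt}(G)$ is the maximum number of classes in a fixatic partition. -}

module Defs where

open import Data.Nat using (ℕ; _≤_)
open import Data.Bool using (Bool; true; false)
open import Data.Fin using (Fin)
open import Data.Fin.Subset using (Subset; _∈_; ∣_∣)
open import Data.Fin.Permutation using (Permutation′; _⟨$⟩ʳ_)
open import Data.Product using (Σ; ∃; _×_; _,_)
open import Function.Definitions using (Surjective)
open import Relation.Binary.PropositionalEquality using (_≡_)

record Graph (n : ℕ) : Set where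
  field
    adj   : Fin n → Fin n → Bool
    sym   : ∀ u v → adj u v ≡ adj v u
    irrfl : ∀ v → adj v v ≡ false
open Graph public

data Reach {n : ℕ} (G : Graph n) : Fin n → Fin n → Set where
  here : ∀ {v} → Reach G v v
  step : ∀ {u w v} → adj G u w ≡ true → Reach G w v → Reach G u v

Connected : ∀ {n} → Graph n → Set
Connected {n} G = (1 ≤ n) × (∀ u v → Reach G u v)

IsAutomorphism : ∀ {n} → Graph n → Permutation′ n → Set
IsAutomorphism G π = ∀ u v → adj G (π ⟨$⟩ʳ u) (π ⟨$⟩ʳ v) ≡ adj G u v

IsFixingSet : ∀ {n} → Graph n → Subset n → Set
IsFixingSet {n} G F =
  (π : Permutation′ n) → IsAutomorphism G π →
  (∀ v → v ∈ F → π ⟨$⟩ʳ v ≡ v) → ∀ v → π ⟨$⟩ʳ v ≡ v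

IsFixingNumber : ∀ {n} → Graph n → ℕ → Set
IsFixingNumber {n} G k =
  (Σ (Subset n) λ F → IsFixingSet G F × ∣ F ∣ ≡ k) ×
  (∀ (F : Subset n) → IsFixingSet G F → k ≤ ∣ F ∣)

-- A partition of V(G) into m (nonempty) classes is given by a surjective
-- class map c : Fin n → Fin m; class i is { v | c v ≡ i }.
IsFixaticPartition : ∀ {n m} → Graph n → (Fin n → Fin m) → Set
IsFixaticPartition {n} {m} G c =
  Surjective _≡_ _≡_ c ×
  (∀ (i : Fin m) → (π : Permutation′ n) → IsAutomorphism G π →
     (∀ v → c v ≡ i → π ⟨$⟩ʳ v ≡ v) → ∀ v → π ⟨$⟩ʳ v ≡ v)

IsFixaticNumber : ∀ {n} → Graph n → ℕ → Set
IsFixaticNumber {n} G m =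
  (Σ (Fin n → Fin m) λ c → IsFixaticPartition G c) ×
  (∀ (m′ : ℕ) (c : Fin n → Fin m′) → IsFixaticPartition G c → m′ ≤ m)

module Submission where

-- The complete graph K_t realises fix + F_xt = t for every t ≥ 3:
-- fix(K_t) = t - 1 and F_xt(K_t) = 1.
--
-- Everything rests on one observation about K_n: every permutation is an
-- automorphism, so if a set of vertices fixes K_n it contains all vertices but
-- at most one (otherwise the transposition of two missing vertices is a
-- non-identity automorphism fixing the set).  Conversely, in ANY graph a set
-- missing at most one vertex is fixing, by injectivity of automorphisms.
--   * fix(K_{n+1}) = n: the vertices other than 0 form a fixing set, and a
--     fixing set misses at most one vertex, hence has at least n elements.
--   * F_xt(K_n) = 1 for n ≥ 3: given two classes, the first misses at most one
--     of three distinct vertices, so contains two of them; both are then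
--     missed by the second class, which is impossible.

open import Defs
open import Data.Nat using (ℕ; _≤_; _+_)
open import Data.Product using (Σ; ∃; _×_)
open import Relation.Binary.PropositionalEquality using (_≡_)

open import Data.Nat using (zero; suc; s≤s; z≤n)
open import Data.Nat.Properties using (+-comm)
open import Data.Bool using (Bool; true; not)
open import Data.Fin using (Fin; zero; suc; _≟_)
open import Data.Fin.Properties using (suc-injective; 0≢1+n)
open import Data.Fin.Subset using (Subset; _∈_; ∣_∣; ⊤; inside; outside)
open import Data.Fin.Subset.Properties using (_∈?_; ∈⊤; ∣⊤∣≡n; p⊆q⇒∣p∣≤∣q∣)
open import Data.Fin.Permutation using (Permutation′; _⟨$⟩ʳ_; transpose)
import Data.Fin.Permutation.Components as Components
open import Data.Vec using (_∷_; there)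
open import Data.Product using (_,_)
open import Data.Empty using (⊥-elim)
open import Function.Bundles using (Injection)
open import Function.Properties.Inverse using (↔⇒↣)
open import Relation.Nullary using (¬_; Dec; yes; no; does)
open import Relation.Nullary.Decidable using (dec-true; dec-false)
open import Relation.Binary.PropositionalEquality
  using (refl; trans; cong; subst) renaming (sym to ≡-sym)

private
  variable
    n : ℕ

-- A fixing set is a fixing predicate `_∈ F`, and a fixatic
-- partition is one whose every class `c v ≡ i` is a fixing predicate.
Fixes : Graph n → (Fin n → Set) → Set
Fixes {n} G P =
  (π : Permutation′ n) → IsAutomorphism G π →
  (∀ v → P v → π ⟨$⟩ʳ v ≡ v) → ∀ v → π ⟨$⟩ʳ v ≡ v

MissesAtMostOne : (Fin n → Set) → Set
MissesAtMostOne {n} P = ∀ (u v : Fin n) → ¬ P u → ¬ P v → u ≡ v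

permutation-injective : (π : Permutation′ n) {u v : Fin n} →
                        π ⟨$⟩ʳ u ≡ π ⟨$⟩ʳ v → u ≡ v
permutation-injective π = Injection.injective (↔⇒↣ π)

-- In any graph, a predicate holding everywhere except possibly at u fixes G:
-- if π fixes all w ≢ u, then π u cannot be any such w (as π w = w), so π u = u.
allButOne-fixes : (G : Graph n) (P : Fin n → Set) (u : Fin n) →
                  (∀ w → ¬ w ≡ u → P w) → Fixes G P
allButOne-fixes G P u covers π _ fixesP v with v ≟ u
... | no v≢u = fixesP v (covers v v≢u)
... | yes refl with π ⟨$⟩ʳ u ≟ u
...   | yes πu≡u = πu≡u
...   | no πu≢u = ⊥-elim (πu≢u (permutation-injective π ππu≡πu))
  where
  ππu≡πu : π ⟨$⟩ʳ (π ⟨$⟩ʳ u) ≡ π ⟨$⟩ʳ u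
  ππu≡πu = fixesP (π ⟨$⟩ʳ u) (covers (π ⟨$⟩ʳ u) πu≢u)

adjacent : Fin n → Fin n → Bool
adjacent u v = not (does (u ≟ v))

decides-sym : (u v : Fin n) → does (u ≟ v) ≡ does (v ≟ u)
decides-sym u v with u ≟ v
... | yes u≡v = ≡-sym (dec-true (v ≟ u) (≡-sym u≡v))
... | no u≢v = ≡-sym (dec-false (v ≟ u) (λ v≡u → u≢v (≡-sym v≡u)))

K : (n : ℕ) → Graph n
K n = record
  { adj   = adjacent
  ; sym   = λ u v → cong not (decides-sym u v)
  ; irrfl = λ v → cong not (dec-true (v ≟ v) refl)
  }

K-edge : {u v : Fin n} → ¬ u ≡ v → adj (K n) u v ≡ true
K-edge {u = u} {v} u≢v = cong not (dec-false (u ≟ v) u≢v)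

K-connected : Connected (K (suc n))
K-connected = s≤s z≤n , walk
  where
  walk : ∀ u v → Reach (K _) u v
  walk u v with u ≟ v
  ... | yes refl = here
  ... | no u≢v = step (K-edge u≢v) here

K-automorphism : (π : Permutation′ n) → IsAutomorphism (K n) π
K-automorphism π u v with u ≟ v
... | yes u≡v = cong not (dec-true (π ⟨$⟩ʳ u ≟ π ⟨$⟩ʳ v) (cong (π ⟨$⟩ʳ_) u≡v))
... | no u≢v = cong not (dec-false (π ⟨$⟩ʳ u ≟ π ⟨$⟩ʳ v)
                                   (λ e → u≢v (permutation-injective π e)))

transpose-moves : (u v : Fin n) → Components.transpose u v u ≡ v
transpose-moves u v rewrite dec-true (u ≟ u) refl = refl

transpose-fixes : (u v w : Fin n) → ¬ w ≡ u → ¬ w ≡ v →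
                  Components.transpose u v w ≡ w
transpose-fixes u v w w≢u w≢v rewrite dec-false (w ≟ u) w≢u | dec-false (w ≟ v) w≢v = refl

-- The key fact: a fixing predicate of K n misses at most one vertex, since
-- otherwise the transposition of two missed vertices would be a
-- non-identity automorphism fixing it.
K-fixing⇒missesAtMostOne : (P : Fin n → Set) → Fixes (K n) P → MissesAtMostOne P
K-fixing⇒missesAtMostOne P fixes u v ¬Pu ¬Pv with u ≟ v
... | yes u≡v = u≡v
... | no u≢v = ⊥-elim (u≢v (trans (≡-sym τu≡u) (transpose-moves u v)))
  where
  τ : Permutation′ _
  τ = transpose u v
  τ-fixesP : ∀ w → P w → τ ⟨$⟩ʳ w ≡ w
  τ-fixesP w Pw = transpose-fixes u v w (λ w≡u → ¬Pu (subst P w≡u Pw))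
                                        (λ w≡v → ¬Pv (subst P w≡v Pw))
  τu≡u : τ ⟨$⟩ʳ u ≡ u
  τu≡u = fixes τ (K-automorphism τ) τ-fixesP u

missesAtMostOne⇒large : (S : Subset (suc n)) → MissesAtMostOne (_∈ S) → n ≤ ∣ S ∣
missesAtMostOne⇒large {n} (outside ∷ S) misses =
  subst (_≤ ∣ S ∣) (∣⊤∣≡n n) (p⊆q⇒∣p∣≤∣q∣ {p = ⊤} (λ {j} _ → everyOther∈S j))
  where
  -- 0 is missed, so every other vertex lies in S.
  everyOther∈S : ∀ j → j ∈ S
  everyOther∈S j with j ∈? S
  ... | yes j∈S = j∈S
  ... | no j∉S with misses zero (suc j) (λ ()) (λ { (there j∈S) → j∉S j∈S })
  ...   | ()
missesAtMostOne⇒large {zero} (inside ∷ S) misses = z≤n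
missesAtMostOne⇒large {suc n} (inside ∷ S) misses =
  s≤s (missesAtMostOne⇒large S λ u v u∉S v∉S →
         suc-injective (misses (suc u) (suc v) (λ { (there u∈S) → u∉S u∈S })
                                               (λ { (there v∈S) → v∉S v∈S })))

allButZero : Subset (suc n)
allButZero = outside ∷ ⊤

K-fixingNumber : IsFixingNumber (K (suc n)) n
K-fixingNumber {n} = (allButZero , allButZero-fixes , ∣⊤∣≡n n) , lowerBound
  where
  covers : ∀ w → ¬ w ≡ zero → w ∈ allButZero
  covers zero w≢0 = ⊥-elim (w≢0 refl)
  covers (suc j) _ = there ∈⊤

  allButZero-fixes : IsFixingSet (K (suc n)) allButZero
  allButZero-fixes = allButOne-fixes (K (suc n)) (_∈ allButZero) zero covers

  lowerBound : ∀ F → IsFixingSet (K (suc n)) F → n ≤ ∣ F ∣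
  lowerBound F fixes = missesAtMostOne⇒large F (K-fixing⇒missesAtMostOne (_∈ F) fixes)

twoOfThree : (P : Fin n → Set) → (∀ v → Dec (P v)) → MissesAtMostOne P →
             (x y z : Fin n) → ¬ x ≡ y → ¬ x ≡ z → ¬ y ≡ z →
             Σ (Fin n) λ a → Σ (Fin n) λ b → ¬ a ≡ b × P a × P b
twoOfThree P P? misses x y z x≢y x≢z y≢z with P? x | P? y | P? z
... | yes Px | yes Py | _      = x , y , x≢y , Px , Py
... | yes Px | no ¬Py | yes Pz = x , z , x≢z , Px , Pz
... | yes _  | no ¬Py | no ¬Pz = ⊥-elim (y≢z (misses y z ¬Py ¬Pz))
... | no ¬Px | yes Py | yes Pz = y , z , y≢z , Py , Pz
... | no ¬Px | yes _  | no ¬Pz = ⊥-elim (x≢z (misses x z ¬Px ¬Pz))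
... | no ¬Px | no ¬Py | _      = ⊥-elim (x≢y (misses x y ¬Px ¬Py))

-- If every fixing predicate of G misses at most one vertex and G has three
-- distinct vertices, then a fixatic partition has at most one class: class 0
-- contains two distinct vertices, which class 1 then both misses.
atMostOneClass : (G : Graph n) → (∀ P → Fixes G P → MissesAtMostOne P) →
                 (x y z : Fin n) → ¬ x ≡ y → ¬ x ≡ z → ¬ y ≡ z →
                 (m : ℕ) (c : Fin n → Fin m) → IsFixaticPartition G c → m ≤ 1
atMostOneClass G missesOne x y z x≢y x≢z y≢z zero c _ = z≤n
atMostOneClass G missesOne x y z x≢y x≢z y≢z (suc zero) c _ = s≤s z≤n
atMostOneClass G missesOne x y z x≢y x≢z y≢z (suc (suc m)) c (_ , classFixes)
  with twoOfThree (λ v → c v ≡ zero) (λ v → c v ≟ zero)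
                  (missesOne _ (classFixes zero)) x y z x≢y x≢z y≢z
... | a , b , a≢b , ca≡0 , cb≡0 =
  ⊥-elim (a≢b (missesOne _ (classFixes (suc zero)) a b (notInClass1 ca≡0) (notInClass1 cb≡0)))
  where
  notInClass1 : ∀ {v} → c v ≡ zero → ¬ c v ≡ suc zero
  notInClass1 cv≡0 cv≡1 = 0≢1+n (trans (≡-sym cv≡0) cv≡1)

singleClass : (G : Graph (suc n)) → IsFixaticPartition G (λ _ → zero {0})
singleClass G = (λ { zero → zero , λ _ → refl }) , λ { zero π _ fixesAll v → fixesAll v refl }

K-fixaticNumber : IsFixaticNumber (K (suc (suc (suc n)))) 1
K-fixaticNumber =
  (_ , singleClass (K _)) ,
  atMostOneClass (K _) K-fixing⇒missesAtMostOne zero (suc zero) (suc (suc zero))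
                 (λ ()) (λ ()) (λ ())

mainTheorem17 : (t : ℕ) → 3 ≤ t →
    Σ ℕ λ n → Σ (Graph n) λ G → Connected G ×
      Σ ℕ λ f → Σ ℕ λ x → IsFixingNumber G f × IsFixaticNumber G x × f + x ≡ t
mainTheorem17 (suc (suc (suc k))) (s≤s (s≤s (s≤s _))) =
  suc (suc (suc k)) , K (suc (suc (suc k))) , K-connected ,
  suc (suc k) , 1 , K-fixingNumber , K-fixaticNumber , +-comm (suc (suc k)) 1
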